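{- Work in Incomprehensive Set Theory (defined in the context). Then: (1) No lower link intersects any upper link: there are no objects $x,y,u,v$ such that $(x,y)$ is a lower ascending or lower descending link, $(u,v)$ is an upper ascending or upper descending link, and $\{x,y\}\cap\{u,v\}\neq\emptyset$ (equivalently, no set is both a lower and an upper). (2) For any lower $x$, the pair $x$ and $x^{++}$ constitutes a lower ascending link, i.e. $x\in x^{++}$, $x\neq x^{++}$, and both $x$ and $x^{++}$ are lowers. (3) For any upper $x$, the pair $x$ and $x^{ -- }$ constitutes an upper descending link, i.e. $x^{ -- }\in x$, $x\neq x^{ -- }$, and both $x$ and $x^{ -- }$ are uppers.
   Context: Incomprehensive Set Theory is the first-order theory in the language $\{\in,=\}$ whose only axioms are: Existence of Successor, $\forall x\,\exists! y\,\forall z\,(z\in y \iff z\in x \lor z=x)$; and Existence of Predecessor, $\forall x\,\exists! y\,\forall z\,(z\in y\iff z\in x\wedge z\neq x)$. No extensionality axiom is assumed. The unique $y$ in the first axiom is written $x^{++}$ (so $x^{++}$ is "$x\cup\{x\}$"), the unique $y$ in the second is written $x^{ -- }$ (so $x^{ -- }$ is "$x\setminus\{x\}$"). An object $x$ is a lower (Lower Russellian Set) if $\forall z\in x,\ z\notin z$; an upper (Upper Russellian Set) if $\forall z\,(z\notin z\Rightarrow z\in x)$. For a predicate $\phi$: $(x,y)$ is a $\phi$ ascending link if $x\in y$, $x\neq y$, $\phi(x)$ and $\phi(y)$; a $\phi$ descending link if $y\in x$, $x\neq y$, $\phi(x)$ and $\phi(y)$. A lower (resp. upper) link is a $\phi$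 link with $\phi$ = "is a lower" (resp. "is an upper"). -}

module Defs where

open import Data.Product using (Σ; ∃; ∃!; _×_; _,_; proj₁)
open import Data.Sum using (_⊎_)
open import Relation.Nullary using (¬_)
open import Relation.Binary.PropositionalEquality using (_≡_)
open import Function.Bundles using (_⇔_)

-- A model of Incomprehensive Set Theory: a domain of objects with a binary
-- membership relation; first-order equality is interpreted as _≡_.
-- No extensionality is assumed.
record IST : Set₁ where
  field
    Obj : Set
    _∈_ : Obj → Obj → Set
    successor   : ∀ x → ∃! _≡_ (λ y → ∀ z → (z ∈ y) ⇔ (z ∈ x ⊎ z ≡ x))
    predecessor : ∀ x → ∃! _≡_ (λ y → ∀ z → (z ∈ y) ⇔ (z ∈ x × ¬ (z ≡ x)))

  _∉_ : Obj → Obj → Set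
  z ∉ y = ¬ (z ∈ y)

  _⁺⁺ : Obj → Obj
  x ⁺⁺ = proj₁ (successor x)

  _⁻⁻ : Obj → Obj
  x ⁻⁻ = proj₁ (predecessor x)

  IsLower : Obj → Set
  IsLower x = ∀ z → z ∈ x → z ∉ z

  IsUpper : Obj → Set
  IsUpper x = ∀ z → z ∉ z → z ∈ x

  AscLink : (Obj → Set) → Obj → Obj → Set
  AscLink φ x y = x ∈ y × ¬ (x ≡ y) × φ x × φ y

  DescLink : (Obj → Set) → Obj → Obj → Set
  DescLink φ x y = y ∈ x × ¬ (x ≡ y) × φ x × φ y

  LowerLink : Obj → Obj → Set
  LowerLink x y = AscLink IsLower x y ⊎ DescLink IsLower x y

  UpperLink : Obj → Obj → Set
  UpperLink u v = AscLink IsUpper u v ⊎ DescLink IsUpper u v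

  PairsMeet : Obj → Obj → Obj → Obj → Set
  PairsMeet x y u v = (x ≡ u ⊎ x ≡ v) ⊎ (y ≡ u ⊎ y ≡ v)

{-# OPTIONS --safe #-}
module Submission where

-- A lower x has x ∉ x (x ∈ x would put a self-member into x), while an upper
-- x has x ∈ x (x ∉ x would force x ∈ x; classically this gives x ∈ x); so no
-- object is both, which rules out lower and upper links sharing an endpoint.
-- Adding x to a lower keeps it lower because x ∉ x, and removing x from an
-- upper keeps it upper because the only object removed, x, is self-membered.
-- Self-membership versus its failure separates x from x⁺⁺ and x⁻⁻, and the
-- upper x⁻⁻ lies in itself, hence in x.

open import Defs
open import Data.Product using (Σ; _×_; _,_; proj₁; proj₂)
open import Data.Sum using (_⊎_; inj₁; inj₂)
open import Data.Empty using (⊥)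
open import Relation.Nullary using (¬_)
open import Relation.Nullary.Decidable using (decidable-stable)
open import Relation.Binary.PropositionalEquality using (_≡_; refl)
open import Axiom.ExcludedMiddle using (ExcludedMiddle)
open import Level using (0ℓ)
open import Function.Bundles using (Equivalence)

module _ (M : IST) where
  open IST M
  open Equivalence

  ∈-⁺⁺ : ∀ {x} z → z ∈ (x ⁺⁺) → z ∈ x ⊎ z ≡ x
  ∈-⁺⁺ {x} z = to (proj₁ (proj₂ (successor x)) z)

  ⁺⁺-∈ : ∀ {x} z → z ∈ x ⊎ z ≡ x → z ∈ (x ⁺⁺)
  ⁺⁺-∈ {x} z = from (proj₁ (proj₂ (successor x)) z)

  ∈-⁻⁻ : ∀ {x} z → z ∈ (x ⁻⁻) → z ∈ x × ¬ z ≡ x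
  ∈-⁻⁻ {x} z = to (proj₁ (proj₂ (predecessor x)) z)

  ⁻⁻-∈ : ∀ {x} z → z ∈ x × ¬ z ≡ x → z ∈ (x ⁻⁻)
  ⁻⁻-∈ {x} z = from (proj₁ (proj₂ (predecessor x)) z)

  x∈x⁺⁺ : ∀ x → x ∈ (x ⁺⁺)
  x∈x⁺⁺ x = ⁺⁺-∈ x (inj₂ refl)

  x∉x⁻⁻ : ∀ x → x ∉ (x ⁻⁻)
  x∉x⁻⁻ x x∈x⁻⁻ = proj₂ (∈-⁻⁻ x x∈x⁻⁻) refl

  ∈-∉⇒≢ : ∀ {x y} → x ∈ x → x ∉ y → ¬ x ≡ y
  ∈-∉⇒≢ x∈x x∉y refl = x∉y x∈x

  ∉-∈⇒≢ : ∀ {x y} → x ∉ x → x ∈ y → ¬ x ≡ y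
  ∉-∈⇒≢ x∉x x∈y refl = x∉x x∈y

  lower⇒∉self : ∀ {x} → IsLower x → x ∉ x
  lower⇒∉self {x} lower x∈x = lower x x∈x x∈x

  upper⇒¬¬∈self : ∀ {x} → IsUpper x → ¬ ¬ x ∈ x
  upper⇒¬¬∈self {x} upper x∉x = x∉x (upper x x∉x)

  ¬lower×upper : ∀ {x} → IsLower x → IsUpper x → ⊥
  ¬lower×upper lower upper = upper⇒¬¬∈self upper (lower⇒∉self lower)

  link-left : ∀ {φ : Obj → Set} {x y} → AscLink φ x y ⊎ DescLink φ x y → φ x
  link-left (inj₁ (_ , _ , φx , _)) = φx
  link-left (inj₂ (_ , _ , φx , _)) = φx

  link-right : ∀ {φ : Obj → Set} {x y} → AscLink φ x y ⊎ DescLink φ x y → φ y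
  link-right (inj₁ (_ , _ , _ , φy)) = φy
  link-right (inj₂ (_ , _ , _ , φy)) = φy

  ¬lowerLink×upperLink-meet : ¬ (Σ Obj λ x → Σ Obj λ y → Σ Obj λ u → Σ Obj λ v →
                                   LowerLink x y × UpperLink u v × PairsMeet x y u v)
  ¬lowerLink×upperLink-meet (_ , _ , _ , _ , ll , ul , inj₁ (inj₁ refl)) =
    ¬lower×upper (link-left ll) (link-left ul)
  ¬lowerLink×upperLink-meet (_ , _ , _ , _ , ll , ul , inj₁ (inj₂ refl)) =
    ¬lower×upper (link-left ll) (link-right ul)
  ¬lowerLink×upperLink-meet (_ , _ , _ , _ , ll , ul , inj₂ (inj₁ refl)) =
    ¬lower×upper (link-right ll) (link-left ul)
  ¬lowerLink×upperLink-meet (_ , _ , _ , _ , ll , ul , inj₂ (inj₂ refl)) =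
    ¬lower×upper (link-right ll) (link-right ul)

  lower⇒⁺⁺-lower : ∀ {x} → IsLower x → IsLower (x ⁺⁺)
  lower⇒⁺⁺-lower lower z z∈x⁺⁺ with ∈-⁺⁺ z z∈x⁺⁺
  ... | inj₁ z∈x  = lower z z∈x
  ... | inj₂ refl = lower⇒∉self lower

  lower⇒⁺⁺-ascLink : ∀ x → IsLower x → AscLink IsLower x (x ⁺⁺)
  lower⇒⁺⁺-ascLink x lower =
    x∈x⁺⁺ x , ∉-∈⇒≢ (lower⇒∉self lower) (x∈x⁺⁺ x) , lower , lower⇒⁺⁺-lower lower

  module _ (em : ExcludedMiddle 0ℓ) where

    upper⇒∈self : ∀ {x} → IsUpper x → x ∈ x
    upper⇒∈self upper = decidable-stable em (upper⇒¬¬∈self upper)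

    upper⇒⁻⁻-upper : ∀ {x} → IsUpper x → IsUpper (x ⁻⁻)
    upper⇒⁻⁻-upper upper z z∉z = ⁻⁻-∈ z (upper z z∉z , z≢x)
      where
      z≢x : ¬ z ≡ _
      z≢x refl = z∉z (upper⇒∈self upper)

    upper⇒⁻⁻-descLink : ∀ x → IsUpper x → DescLink IsUpper x (x ⁻⁻)
    upper⇒⁻⁻-descLink x upper =
      x⁻⁻∈x , ∈-∉⇒≢ (upper⇒∈self upper) (x∉x⁻⁻ x) , upper , upper⁻⁻
      where
      upper⁻⁻ : IsUpper (x ⁻⁻)
      upper⁻⁻ = upper⇒⁻⁻-upper upper
      x⁻⁻∈x : (x ⁻⁻) ∈ x
      x⁻⁻∈x = proj₁ (∈-⁻⁻ (x ⁻⁻) (upper⇒∈self upper⁻⁻))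

theorem4p6 : ExcludedMiddle 0ℓ → (M : IST) → let open IST M in
    (¬ (Σ Obj λ x → Σ Obj λ y → Σ Obj λ u → Σ Obj λ v →
    LowerLink x y × UpperLink u v × PairsMeet x y u v))
    × (∀ x → IsLower x → AscLink IsLower x (x ⁺⁺))
    × (∀ x → IsUpper x → DescLink IsUpper x (x ⁻⁻))
theorem4p6 em M =
  ¬lowerLink×upperLink-meet M , lower⇒⁺⁺-ascLink M , upper⇒⁻⁻-descLink M em
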